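{- Let $q>2$ be a power of $2$, let $t\in\mathbb{F}_q^*$, and let $f=x+t x^q+x^{2q-1}\in\mathbb{F}_q[x]$. Then $f$ is a permutation polynomial of $\mathbb{F}_{q^2}$ if and only if $\mathrm{Tr}_{q/2}(1/t)=0$.
   Context: $\mathbb{F}_q$ denotes the finite field with $q$ elements, and $\mathrm{Tr}_{q/2}:\mathbb{F}_q\to\mathbb{F}_2$ is the absolute trace map. A polynomial $f$ is a permutation polynomial of $\mathbb{F}_{q^2}$ if the map $x\mapsto f(x)$ is a bijection of $\mathbb{F}_{q^2}$. -}

module Defs where

open import Level using (Level; _⊔_)
open import Data.Nat using (ℕ; zero; suc)
open import Data.Fin using (Fin)
open import Data.Product using (Σ; ∃; _×_)
open import Relation.Binary.PropositionalEquality using (_≡_)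
open import Relation.Nullary using (¬_)
open import Algebra.Bundles using (CommutativeRing)

module _ {c ℓ : Level} (R : CommutativeRing c ℓ) where
  open CommutativeRing R

  pow : Carrier → ℕ → Carrier
  pow x zero    = 1#
  pow x (suc n) = x * pow x n

  IsField : Set (c ⊔ ℓ)
  IsField = (1# ≉ 0#) × (∀ x → x ≉ 0# → ∃ λ y → x * y ≈ 1#)

  HasCard : ℕ → Set (c ⊔ ℓ)
  HasCard n = Σ (Fin n → Carrier) λ e →
                (∀ i j → e i ≈ e j → i ≡ j) × (∀ x → ∃ λ i → e i ≈ x)

  IsPermutation : (Carrier → Carrier) → Set (c ⊔ ℓ)
  IsPermutation f = (∀ x y → f x ≈ f y → x ≈ y) × (∀ z → ∃ λ x → f x ≈ z)

  -- absolute trace Tr_{2^m/2}(y) = y + y^2 + y^4 + ... + y^(2^(m-1))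
  AbsTrace : ℕ → Carrier → Carrier
  AbsTrace zero    y = 0#
  AbsTrace (suc m) y = y + AbsTrace m (y * y)

module Submission where

-- For x ≠ 0 put ρ = x^(q-1); then ρ^(q+1) = 1 and f(x) = x·h(ρ) with h(ρ) = 1 + tρ + ρ².
-- If h has no root of norm one, f is a bijection: ρ is read off f(x), because f(x)^q·ρ = f(x),
-- and then x = f(x)/h(ρ). A root ρ of norm one makes z = ρ/t a solution of z² + z = 1/t², so
-- z^q + z = Tr(1/t)², and Tr(1/t) = 0 forces ρ ∈ 𝔽_q, whence ρ = 1 and h(1) = t ≠ 0. When
-- Tr(1/t) = 1 an explicit nonzero root of f is built from an element a with a^q + a = 1.
-- Characteristic 2 and x^(q²) = x are derived from the cardinality by counting arguments.

open import Defs
open import Level using (Level)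
open import Data.Nat using (ℕ; _≤_; _^_; _∸_) renaming (_*_ to _*ℕ_)
open import Function.Bundles using (_⇔_)
open import Algebra.Bundles using (CommutativeRing)

import Algebra.Properties.CommutativeMonoid.Sum as Sum
import Algebra.Properties.Group as GroupProperties
import Data.Fin.Properties as Finₚ
import Data.List.Properties as Listₚ
import Data.Nat.Properties as ℕₚ
open import Data.Empty using (⊥-elim)
open import Data.Fin using (Fin; zero; suc; inject≤)
open import Data.Fin.Permutation using (Permutation; permutation; _⟨$⟩ʳ_)
open import Data.List using (List; []; _∷_; length; replicate)
open import Data.Maybe using (nothing)
open import Data.Nat as ℕ using (zero; suc; _<_)
open import Data.Product using (∃; _×_; _,_; proj₁; proj₂)
open import Data.Vec.Functional using (removeAt)
open import Function.Bundles using (mk⇔)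
open import Relation.Binary.Definitions using (Decidable)
open import Relation.Binary.PropositionalEquality as ≡ using (_≡_; _≢_)
open import Relation.Nullary using (¬_; yes; no)
open import Relation.Nullary.Decidable using (decidable-stable)

module Powers {c ℓ : Level} (K : CommutativeRing c ℓ) where
  open CommutativeRing K
  import Algebra.Properties.Semiring.Exp semiring as Exp
  import Algebra.Properties.CommutativeSemiring.Exp commutativeSemiring as CExp

  pow≡^ : ∀ x n → pow K x n ≡ x Exp.^ n
  pow≡^ x zero    = ≡.refl
  pow≡^ x (suc n) = ≡.cong (x *_) (pow≡^ x n)

  pow-congˡ : ∀ n {x y} → x ≈ y → pow K x n ≈ pow K y n
  pow-congˡ n {x} {y} x≈y rewrite pow≡^ x n | pow≡^ y n = Exp.^-congˡ n x≈y

  pow-homo-* : ∀ x m n → pow K x (m ℕ.+ n) ≈ pow K x m * pow K x n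
  pow-homo-* x m n rewrite pow≡^ x (m ℕ.+ n) | pow≡^ x m | pow≡^ x n = Exp.^-homo-* x m n

  pow-assocʳ : ∀ x m n → pow K (pow K x m) n ≈ pow K x (m *ℕ n)
  pow-assocʳ x m n rewrite pow≡^ (pow K x m) n | pow≡^ x m | pow≡^ x (m *ℕ n) =
    Exp.^-assocʳ x m n

  pow-distrib-* : ∀ x y n → pow K (x * y) n ≈ pow K x n * pow K y n
  pow-distrib-* x y n rewrite pow≡^ (x * y) n | pow≡^ x n | pow≡^ y n = CExp.^-distrib-* x y n

  pow-1# : ∀ n → pow K 1# n ≈ 1#
  pow-1# zero    = refl
  pow-1# (suc n) = trans (*-identityˡ _) (pow-1# n)

  pow-0# : ∀ n → 1 ≤ n → pow K 0# n ≈ 0#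
  pow-0# (suc n) _ = zeroˡ _

  x*pow[2n∸1]≈pow[n]² : ∀ x n → 1 ≤ n → x * pow K x (2 *ℕ n ∸ 1) ≈ pow K x n * pow K x n
  x*pow[2n∸1]≈pow[n]² x n@(suc _) _ =
    trans (pow-homo-* x n (n ℕ.+ 0)) (*-congˡ (reflexive (≡.cong (pow K x) (ℕₚ.+-identityʳ n))))

module FieldProperties {c ℓ : Level} (K : CommutativeRing c ℓ) (isField : IsField K) where
  open CommutativeRing K
  open import Relation.Binary.Reasoning.Setoid setoid

  1≉0 : 1# ≉ 0#
  1≉0 = proj₁ isField

  division : ∀ x {y} → y ≉ 0# → ∃ λ z → z * y ≈ x
  division x {y} y≉0 with proj₂ isField y y≉0
  ... | y⁻¹ , y*y⁻¹≈1 = x * y⁻¹ , (begin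
    x * y⁻¹ * y   ≈⟨ *-assoc x y⁻¹ y ⟩
    x * (y⁻¹ * y) ≈⟨ *-congˡ (trans (*-comm y⁻¹ y) y*y⁻¹≈1) ⟩
    x * 1#        ≈⟨ *-identityʳ x ⟩
    x             ∎)

  *-cancelʳ-≉0 : ∀ {x y z} → z ≉ 0# → x * z ≈ y * z → x ≈ y
  *-cancelʳ-≉0 {x} {y} {z} z≉0 xz≈yz with proj₂ isField z z≉0
  ... | z⁻¹ , z*z⁻¹≈1 = begin
    x             ≈⟨ sym (*-identityʳ x) ⟩
    x * 1#        ≈⟨ *-congˡ (sym z*z⁻¹≈1) ⟩
    x * (z * z⁻¹) ≈⟨ sym (*-assoc x z z⁻¹) ⟩
    x * z * z⁻¹   ≈⟨ *-congʳ xz≈yz ⟩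
    y * z * z⁻¹   ≈⟨ *-assoc y z z⁻¹ ⟩
    y * (z * z⁻¹) ≈⟨ *-congˡ z*z⁻¹≈1 ⟩
    y * 1#        ≈⟨ *-identityʳ y ⟩
    y             ∎

  *-cancelˡ-≉0 : ∀ {x y z} → x ≉ 0# → x * y ≈ x * z → y ≈ z
  *-cancelˡ-≉0 {x} {y} {z} x≉0 xy≈xz =
    *-cancelʳ-≉0 x≉0 (trans (*-comm y x) (trans xy≈xz (*-comm x z)))

  *≈0⇒≈0 : ∀ {x y} → x ≉ 0# → x * y ≈ 0# → y ≈ 0#
  *≈0⇒≈0 {x} x≉0 xy≈0 = *-cancelˡ-≉0 x≉0 (trans xy≈0 (sym (zeroʳ x)))

  *-≉0 : ∀ {x y} → x ≉ 0# → y ≉ 0# → x * y ≉ 0#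
  *-≉0 x≉0 y≉0 xy≈0 = y≉0 (*≈0⇒≈0 x≉0 xy≈0)

  pow-≉0 : ∀ {x} n → x ≉ 0# → pow K x n ≉ 0#
  pow-≉0 zero    x≉0 = 1≉0
  pow-≉0 (suc n) x≉0 = *-≉0 x≉0 (pow-≉0 n x≉0)

HasCharacteristic2 : {c ℓ : Level} → CommutativeRing c ℓ → Set ℓ
HasCharacteristic2 K = 1# + 1# ≈ 0#
  where open CommutativeRing K

module CharacteristicTwo {c ℓ : Level} (K : CommutativeRing c ℓ) (char2 : HasCharacteristic2 K) where
  open CommutativeRing K
  open Powers K
  open import Algebra.Solver.Ring.NaturalCoefficients commutativeSemiring (λ _ _ → nothing)
  open import Relation.Binary.Reasoning.Setoid setoid

  x+x≈0 : ∀ x → x + x ≈ 0#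
  x+x≈0 x = begin
    x + x             ≈⟨ sym (+-cong (*-identityˡ x) (*-identityˡ x)) ⟩
    1# * x + 1# * x   ≈⟨ sym (distribʳ x 1# 1#) ⟩
    (1# + 1#) * x     ≈⟨ *-congʳ char2 ⟩
    0# * x            ≈⟨ zeroˡ x ⟩
    0#                ∎

  x+y≈z⇒x≈z+y : ∀ {x y z} → x + y ≈ z → x ≈ z + y
  x+y≈z⇒x≈z+y {x} {y} {z} x+y≈z = begin
    x             ≈⟨ sym (+-identityʳ x) ⟩
    x + 0#        ≈⟨ +-congˡ (sym (x+x≈0 y)) ⟩
    x + (y + y)   ≈⟨ sym (+-assoc x y y) ⟩
    (x + y) + y   ≈⟨ +-congʳ x+y≈z ⟩
    z + y         ∎

  x+y≈0⇒x≈y : ∀ {x y} → x + y ≈ 0# → x ≈ y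
  x+y≈0⇒x≈y x+y≈0 = trans (x+y≈z⇒x≈z+y x+y≈0) (+-identityˡ _)

  square-+ : ∀ x y → (x + y) * (x + y) ≈ x * x + y * y
  square-+ x y = begin
    (x + y) * (x + y)                ≈⟨ expand x y ⟩
    x * x + y * y + (x * y + x * y)  ≈⟨ +-congˡ (x+x≈0 (x * y)) ⟩
    x * x + y * y + 0#               ≈⟨ +-identityʳ _ ⟩
    x * x + y * y                    ∎
    where
    expand : ∀ x y → (x + y) * (x + y) ≈ x * x + y * y + (x * y + x * y)
    expand = solve 2 (λ x y → (x :+ y) :* (x :+ y) := x :* x :+ y :* y :+ (x :* y :+ x :* y)) refl

  pow-2^-suc : ∀ x k → pow K x (2 ^ suc k) ≈ pow K (x * x) (2 ^ k)
  pow-2^-suc x k = trans (sym (pow-assocʳ x 2 (2 ^ k))) (pow-congˡ (2 ^ k) (*-congˡ (*-identityʳ x)))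

  pow-2^-+ : ∀ x y k → pow K (x + y) (2 ^ k) ≈ pow K x (2 ^ k) + pow K y (2 ^ k)
  pow-2^-+ x y zero    = trans (*-identityʳ _) (sym (+-cong (*-identityʳ x) (*-identityʳ y)))
  pow-2^-+ x y (suc k) = begin
    pow K (x + y) (2 ^ suc k)                       ≈⟨ pow-2^-suc (x + y) k ⟩
    pow K ((x + y) * (x + y)) (2 ^ k)               ≈⟨ pow-congˡ (2 ^ k) (square-+ x y) ⟩
    pow K (x * x + y * y) (2 ^ k)                   ≈⟨ pow-2^-+ (x * x) (y * y) k ⟩
    pow K (x * x) (2 ^ k) + pow K (y * y) (2 ^ k)   ≈⟨ sym (+-cong (pow-2^-suc x k) (pow-2^-suc y k)) ⟩
    pow K x (2 ^ suc k) + pow K y (2 ^ suc k)       ∎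

  ℘ : Carrier → Carrier
  ℘ z = z * z + z

  Tr : ℕ → Carrier → Carrier
  Tr = AbsTrace K

  Tr-cong : ∀ k {x y} → x ≈ y → Tr k x ≈ Tr k y
  Tr-cong zero    x≈y = refl
  Tr-cong (suc k) x≈y = +-cong x≈y (Tr-cong k (*-cong x≈y x≈y))

  Tr-square : ∀ k y → Tr k (y * y) ≈ Tr k y * Tr k y
  Tr-square zero    y = sym (zeroˡ 0#)
  Tr-square (suc k) y = begin
    y * y + Tr k ((y * y) * (y * y))          ≈⟨ +-congˡ (Tr-square k (y * y)) ⟩
    y * y + Tr k (y * y) * Tr k (y * y)       ≈⟨ sym (square-+ y (Tr k (y * y))) ⟩
    (y + Tr k (y * y)) * (y + Tr k (y * y))   ∎

  Tr-℘ : ∀ k z → Tr k (℘ z) ≈ pow K z (2 ^ k) + z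
  Tr-℘ zero    z = sym (trans (+-congʳ (*-identityʳ z)) (x+x≈0 z))
  Tr-℘ (suc k) z = begin
    ℘ z + Tr k (℘ z * ℘ z)                 ≈⟨ +-congˡ (Tr-cong k (square-+ (z * z) z)) ⟩
    ℘ z + Tr k (℘ (z * z))                 ≈⟨ +-congˡ (Tr-℘ k (z * z)) ⟩
    ℘ z + (pow K (z * z) (2 ^ k) + z * z)  ≈⟨ regroup (z * z) z (pow K (z * z) (2 ^ k)) ⟩
    pow K (z * z) (2 ^ k) + z + (z * z + z * z) ≈⟨ +-congˡ (x+x≈0 (z * z)) ⟩
    pow K (z * z) (2 ^ k) + z + 0#         ≈⟨ +-identityʳ _ ⟩
    pow K (z * z) (2 ^ k) + z              ≈⟨ +-congʳ (sym (pow-2^-suc z k)) ⟩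
    pow K z (2 ^ suc k) + z                ∎
    where
    regroup : ∀ s z p → s + z + (p + s) ≈ p + z + (s + s)
    regroup = solve 3 (λ s z p → s :+ z :+ (p :+ s) := p :+ z :+ (s :+ s)) refl

  ℘-Tr : ∀ k y → ℘ (Tr k y) ≈ pow K y (2 ^ k) + y
  ℘-Tr zero    y = trans (+-identityʳ _) (trans (zeroˡ 0#) (sym (trans (+-congʳ (*-identityʳ y)) (x+x≈0 y))))
  ℘-Tr (suc k) y = begin
    ℘ (y + T)                          ≈⟨ +-congʳ (square-+ y T) ⟩
    y * y + T * T + (y + T)            ≈⟨ regroup (y * y) (T * T) y T ⟩
    y * y + y + ℘ T                    ≈⟨ +-congˡ (℘-Tr k (y * y)) ⟩
    y * y + y + (pow K (y * y) (2 ^ k) + y * y) ≈⟨ regroup′ (y * y) y (pow K (y * y) (2 ^ k)) ⟩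
    pow K (y * y) (2 ^ k) + y + (y * y + y * y) ≈⟨ +-congˡ (x+x≈0 (y * y)) ⟩
    pow K (y * y) (2 ^ k) + y + 0#     ≈⟨ +-identityʳ _ ⟩
    pow K (y * y) (2 ^ k) + y          ≈⟨ +-congʳ (sym (pow-2^-suc y k)) ⟩
    pow K y (2 ^ suc k) + y            ∎
    where
    T = Tr k (y * y)
    regroup : ∀ a b c d → a + b + (c + d) ≈ a + c + (b + d)
    regroup = solve 4 (λ a b c d → a :+ b :+ (c :+ d) := a :+ c :+ (b :+ d)) refl
    regroup′ : ∀ s y p → s + y + (p + s) ≈ p + y + (s + s)
    regroup′ = solve 3 (λ s y p → s :+ y :+ (p :+ s) := p :+ y :+ (s :+ s)) refl

module MonicPolynomials {c ℓ : Level} (K : CommutativeRing c ℓ) (isField : IsField K) where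
  open CommutativeRing K hiding (zero)
  open FieldProperties K isField
  open GroupProperties +-group using (x∙y⁻¹≈ε⇒x≈y)
  open import Algebra.Solver.Ring.NaturalCoefficients commutativeSemiring (λ _ _ → nothing)
  open import Relation.Binary.Reasoning.Setoid setoid

  -- [d₀, …, d_{k-1}] stands for the monic polynomial d₀ + d₁ x + ⋯ + d_{k-1} x^(k-1) + x^k.
  eval : List Carrier → Carrier → Carrier
  eval []       x = 1#
  eval (d ∷ ds) x = d + x * eval ds x

  eval-cong : ∀ p {x y} → x ≈ y → eval p x ≈ eval p y
  eval-cong []       x≈y = refl
  eval-cong (d ∷ ds) x≈y = +-congˡ (*-cong x≈y (eval-cong ds x≈y))

  quotient : Carrier → List Carrier → List Carrier
  quotient a []            = []
  quotient a (d ∷ [])      = []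
  quotient a (d ∷ d′ ∷ ds) = eval (d′ ∷ ds) a ∷ quotient a (d′ ∷ ds)

  length-quotient : ∀ a d ds → length (quotient a (d ∷ ds)) ≡ length ds
  length-quotient a d []        = ≡.refl
  length-quotient a d (d′ ∷ ds) = ≡.cong suc (length-quotient a d′ ds)

  -- Stated at the point s + a, so that it is an identity of commutative semirings.
  eval-quotient-+ : ∀ a s d ds →
    eval (d ∷ ds) (s + a) ≈ s * eval (quotient a (d ∷ ds)) (s + a) + eval (d ∷ ds) a
  eval-quotient-+ a s d [] = identity d s a
    where
    identity : ∀ d s a → d + (s + a) * 1# ≈ s * 1# + (d + a * 1#)
    identity = solve 3 (λ d s a → d :+ (s :+ a) :* con 1 := s :* con 1 :+ (d :+ a :* con 1)) refl
  eval-quotient-+ a s d (d′ ∷ ds) = begin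
    d + (s + a) * eval (d′ ∷ ds) (s + a) ≈⟨ +-congˡ (*-congˡ (eval-quotient-+ a s d′ ds)) ⟩
    d + (s + a) * (s * Q + E)           ≈⟨ identity d s a Q E ⟩
    s * (E + (s + a) * Q) + (d + a * E) ∎
    where
    E = eval (d′ ∷ ds) a
    Q = eval (quotient a (d′ ∷ ds)) (s + a)
    identity : ∀ d s a Q E → d + (s + a) * (s * Q + E) ≈ s * (E + (s + a) * Q) + (d + a * E)
    identity = solve 5 (λ d s a Q E →
      d :+ (s :+ a) :* (s :* Q :+ E) := s :* (E :+ (s :+ a) :* Q) :+ (d :+ a :* E)) refl

  eval-quotient : ∀ a x d ds →
    eval (d ∷ ds) x ≈ (x - a) * eval (quotient a (d ∷ ds)) x + eval (d ∷ ds) a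
  eval-quotient a x d ds = begin
    eval (d ∷ ds) x                                            ≈⟨ eval-cong (d ∷ ds) x≈s+a ⟩
    eval (d ∷ ds) (s + a)                                      ≈⟨ eval-quotient-+ a s d ds ⟩
    s * eval (quotient a (d ∷ ds)) (s + a) + eval (d ∷ ds) a   ≈⟨ +-congʳ (*-congˡ (eval-cong (quotient a (d ∷ ds)) (sym x≈s+a))) ⟩
    s * eval (quotient a (d ∷ ds)) x + eval (d ∷ ds) a         ∎
    where
    s = x - a
    x≈s+a : x ≈ s + a
    x≈s+a = sym (trans (+-assoc x (- a) a) (trans (+-congˡ (-‿inverseˡ a)) (+-identityʳ x)))

  root-bound : ∀ {k} p → length p ≡ k → (r : Fin (suc k) → Carrier) →
               (∀ i j → r i ≈ r j → i ≡ j) → ¬ (∀ i → eval p (r i) ≈ 0#)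
  root-bound []       _          r r-injective roots = 1≉0 (roots zero)
  root-bound {suc k} (d ∷ ds) |p|≡1+k r r-injective roots =
    root-bound (quotient (r zero) (d ∷ ds)) (≡.trans (length-quotient _ d ds) (ℕₚ.suc-injective |p|≡1+k))
      (λ i → r (suc i)) (λ i j rᵢ≈rⱼ → Finₚ.suc-injective (r-injective (suc i) (suc j) rᵢ≈rⱼ))
      quotient-roots
    where
    quotient-roots : ∀ i → eval (quotient (r zero) (d ∷ ds)) (r (suc i)) ≈ 0#
    quotient-roots i = *≈0⇒≈0 difference≉0 (begin
      (r (suc i) - r zero) * eval (quotient (r zero) (d ∷ ds)) (r (suc i))        ≈⟨ sym (+-identityʳ _) ⟩
      (r (suc i) - r zero) * eval (quotient (r zero) (d ∷ ds)) (r (suc i)) + 0#   ≈⟨ +-congˡ (sym (roots zero)) ⟩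
      (r (suc i) - r zero) * eval (quotient (r zero) (d ∷ ds)) (r (suc i)) + eval (d ∷ ds) (r zero)
                                                                                  ≈⟨ sym (eval-quotient (r zero) (r (suc i)) d ds) ⟩
      eval (d ∷ ds) (r (suc i))                                                   ≈⟨ roots (suc i) ⟩
      0#                                                                          ∎)
      where
      difference≉0 : r (suc i) - r zero ≉ 0#
      difference≉0 d≈0 with r-injective (suc i) zero (x∙y⁻¹≈ε⇒x≈y _ _ d≈0)
      ... | ()

  pow-minus-id : ℕ → List Carrier
  pow-minus-id k = 0# ∷ - 1# ∷ replicate k 0#

  length-pow-minus-id : ∀ k → length (pow-minus-id k) ≡ suc (suc k)
  length-pow-minus-id k = ≡.cong (λ j → suc (suc j)) (Listₚ.length-replicate k)

  eval-replicate-0# : ∀ k x → eval (replicate k 0#) x ≈ pow K x k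
  eval-replicate-0# zero    x = refl
  eval-replicate-0# (suc k) x = trans (+-identityˡ _) (*-congˡ (eval-replicate-0# k x))

  fixed-point-root : ∀ k {w} → pow K w (suc (suc k)) ≈ w → eval (pow-minus-id k) w ≈ 0#
  fixed-point-root k {w} w²⁺ᵏ≈w = begin
    0# + w * (- 1# + w * eval (replicate k 0#) w) ≈⟨ +-identityˡ _ ⟩
    w * (- 1# + w * eval (replicate k 0#) w)      ≈⟨ *-congˡ (+-congˡ (*-congˡ (eval-replicate-0# k w))) ⟩
    w * (- 1# + pow K w (suc k))                   ≈⟨ distribˡ w (- 1#) _ ⟩
    w * - 1# + pow K w (suc (suc k))               ≈⟨ +-congˡ (trans w²⁺ᵏ≈w (sym (*-identityʳ w))) ⟩
    w * - 1# + w * 1#                              ≈⟨ sym (distribˡ w (- 1#) 1#) ⟩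
    w * (- 1# + 1#)                                ≈⟨ *-congˡ (-‿inverseˡ 1#) ⟩
    w * 0#                                         ≈⟨ zeroʳ w ⟩
    0#                                             ∎

module FiniteField {c ℓ : Level} (K : CommutativeRing c ℓ) (isField : IsField K)
                   (n : ℕ) (card : HasCard K n) where
  open CommutativeRing K hiding (zero)
  open Powers K
  open FieldProperties K isField
  open MonicPolynomials K isField
  open import Algebra.Properties.Semiring.Mult semiring using (×-homo-1; ×1-homo-*)
    renaming (_×_ to _·_)
  open import Relation.Binary.Reasoning.Setoid setoid
  module ∑ = Sum +-commutativeMonoid
  module ∏ = Sum *-commutativeMonoid

  enum : Fin n → Carrier
  enum = proj₁ card

  enum-injective : ∀ i j → enum i ≈ enum j → i ≡ j
  enum-injective = proj₁ (proj₂ card)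

  index : Carrier → Fin n
  index x = proj₁ (proj₂ (proj₂ card) x)

  enum-index : ∀ x → enum (index x) ≈ x
  enum-index x = proj₂ (proj₂ (proj₂ card) x)

  infix 4 _≟_
  _≟_ : Decidable _≈_
  x ≟ y with index x Finₚ.≟ index y
  ... | yes iₓ≡iᵧ = yes (trans (sym (enum-index x)) (trans (reflexive (≡.cong enum iₓ≡iᵧ)) (enum-index y)))
  ... | no  iₓ≢iᵧ = no λ x≈y → iₓ≢iᵧ (enum-injective _ _ (trans (enum-index x) (trans x≈y (sym (enum-index y)))))

  pow≈0⇒≈0 : ∀ k {x} → pow K x k ≈ 0# → x ≈ 0#
  pow≈0⇒≈0 k {x} xᵏ≈0 with x ≟ 0#
  ... | yes x≈0 = x≈0
  ... | no  x≉0 = ⊥-elim (pow-≉0 k x≉0 xᵏ≈0)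

  enumPermutation : (g g′ : Carrier → Carrier) →
                    (∀ {x y} → x ≈ y → g x ≈ g y) → (∀ {x y} → x ≈ y → g′ x ≈ g′ y) →
                    (∀ x → g (g′ x) ≈ x) → (∀ x → g′ (g x) ≈ x) → Permutation n n
  enumPermutation g g′ g-cong g′-cong g∘g′≈id g′∘g≈id =
    permutation (λ i → index (g (enum i))) (λ i → index (g′ (enum i)))
      (λ i → enum-injective _ _ (trans (enum-index _) (trans (g-cong (enum-index _)) (g∘g′≈id (enum i)))))
      (λ i → enum-injective _ _ (trans (enum-index _) (trans (g′-cong (enum-index _)) (g′∘g≈id (enum i)))))

  -- Summing over all elements is invariant under the translation x ↦ x + 1.
  n·1≈0 : n · 1# ≈ 0#
  n·1≈0 = begin
    n · 1#                        ≈⟨ sym (+-identityˡ _) ⟩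
    0# + n · 1#                   ≈⟨ +-congʳ (sym (-‿inverseˡ Σ)) ⟩
    (- Σ + Σ) + n · 1#            ≈⟨ +-assoc (- Σ) Σ _ ⟩
    - Σ + (Σ + n · 1#)            ≈⟨ +-congˡ (+-congˡ (sym (∑.sum-replicate n))) ⟩
    - Σ + (Σ + ∑.sum {n} (λ _ → 1#)) ≈⟨ +-congˡ (sym (∑.∑-distrib-+ enum (λ _ → 1#))) ⟩
    - Σ + ∑.sum (λ i → enum i + 1#) ≈⟨ +-congˡ (sym (∑.sum-cong-≋ (λ i → enum-index (enum i + 1#)))) ⟩
    - Σ + ∑.sum (λ i → enum (π ⟨$⟩ʳ i)) ≈⟨ +-congˡ (sym (∑.sum-permute enum π)) ⟩
    - Σ + Σ                       ≈⟨ -‿inverseˡ Σ ⟩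
    0#                            ∎
    where
    Σ = ∑.sum enum
    π = enumPermutation (_+ 1#) (_+ - 1#) +-congʳ +-congʳ
          (λ x → trans (+-assoc x _ _) (trans (+-congˡ (-‿inverseˡ 1#)) (+-identityʳ x)))
          (λ x → trans (+-assoc x _ _) (trans (+-congˡ (-‿inverseʳ 1#)) (+-identityʳ x)))

  ·1-homo-pow : ∀ a k → (a ^ k) · 1# ≈ pow K (a · 1#) k
  ·1-homo-pow a zero    = ×-homo-1 1#
  ·1-homo-pow a (suc k) = trans (×1-homo-* a (a ^ k)) (*-congˡ (·1-homo-pow a k))

  characteristic-two : ∀ k → n ≡ 2 ^ k → HasCharacteristic2 K
  characteristic-two k n≡2ᵏ = trans (+-congˡ (sym (+-identityʳ 1#))) (pow≈0⇒≈0 k (begin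
    pow K (2 · 1#) k  ≈⟨ sym (·1-homo-pow 2 k) ⟩
    (2 ^ k) · 1#      ≡⟨ ≡.cong (_· 1#) (≡.sym n≡2ᵏ) ⟩
    n · 1#            ≈⟨ n·1≈0 ⟩
    0#                ∎))

  ∏-single : ∀ {k} (g : Fin k → Carrier) i → (∀ j → j ≢ i → g j ≈ 1#) → ∏.sum g ≈ g i
  ∏-single {suc k} g i g≈1 = begin
    ∏.sum g                     ≈⟨ ∏.sum-remove {i = i} g ⟩
    g i * ∏.sum (removeAt g i)  ≈⟨ *-congˡ (∏.sum-cong-≋ {k} {removeAt g i} {λ _ → 1#} λ j → g≈1 _ (Finₚ.punchInᵢ≢i i j)) ⟩
    g i * ∏.sum {k} (λ _ → 1#)  ≈⟨ *-congˡ (∏.sum-replicate-zero k) ⟩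
    g i * 1#                    ≈⟨ *-identityʳ _ ⟩
    g i                         ∎

  nonzeroOr1 : Carrier → Carrier
  nonzeroOr1 y with y ≟ 0#
  ... | yes _ = 1#
  ... | no  _ = y

  nonzeroOr1-≉0 : ∀ y → nonzeroOr1 y ≉ 0#
  nonzeroOr1-≉0 y with y ≟ 0#
  ... | yes _   = 1≉0
  ... | no  y≉0 = y≉0

  nonzeroOr1-cong : ∀ {y y′} → y ≈ y′ → nonzeroOr1 y ≈ nonzeroOr1 y′
  nonzeroOr1-cong {y} {y′} y≈y′ with y ≟ 0# | y′ ≟ 0#
  ... | yes _   | yes _    = refl
  ... | yes y≈0 | no  y′≉0 = ⊥-elim (y′≉0 (trans (sym y≈y′) y≈0))
  ... | no  y≉0 | yes y′≈0 = ⊥-elim (y≉0 (trans y≈y′ y′≈0))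
  ... | no  _   | no  _    = y≈y′

  ∏-≉0 : ∀ {k} (g : Fin k → Carrier) → (∀ i → g i ≉ 0#) → ∏.sum g ≉ 0#
  ∏-≉0 {zero}  g g≉0 = 1≉0
  ∏-≉0 {suc k} g g≉0 = *-≉0 (g≉0 zero) (∏-≉0 (λ i → g (suc i)) (λ i → g≉0 (suc i)))

  atZero : Carrier → Carrier → Carrier
  atZero x y with y ≟ 0#
  ... | yes _ = x
  ... | no  _ = 1#

  ∏-atZero : ∀ x → ∏.sum (λ i → atZero x (enum i)) ≈ x
  ∏-atZero x = trans (∏-single (λ i → atZero x (enum i)) (index 0#) atZero-≉0) atZero-0
    where
    atZero-0 : atZero x (enum (index 0#)) ≈ x
    atZero-0 with enum (index 0#) ≟ 0#
    ... | yes _   = refl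
    ... | no  e≉0 = ⊥-elim (e≉0 (enum-index 0#))
    atZero-≉0 : ∀ j → j ≢ index 0# → atZero x (enum j) ≈ 1#
    atZero-≉0 j j≢i₀ with enum j ≟ 0#
    ... | yes e≈0 = ⊥-elim (j≢i₀ (enum-injective _ _ (trans e≈0 (sym (enum-index 0#)))))
    ... | no  _   = refl

  nonzeroOr1-* : ∀ {x} → x ≉ 0# → ∀ y → nonzeroOr1 (x * y) * atZero x y ≈ x * nonzeroOr1 y
  nonzeroOr1-* {x} x≉0 y with y ≟ 0# | x * y ≟ 0#
  ... | yes _   | yes _    = trans (*-identityˡ x) (sym (*-identityʳ x))
  ... | yes y≈0 | no  xy≉0 = ⊥-elim (xy≉0 (trans (*-congˡ y≈0) (zeroʳ x)))
  ... | no  y≉0 | yes xy≈0 = ⊥-elim (*-≉0 x≉0 y≉0 xy≈0)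
  ... | no  _   | no  _    = *-identityʳ _

  scaling : ∀ {x} → x ≉ 0# → Permutation n n
  scaling {x} x≉0 = enumPermutation (x *_) (x⁻¹ *_) *-congˡ *-congˡ
    (λ y → trans (sym (*-assoc x x⁻¹ y)) (trans (*-congʳ (trans (*-comm x x⁻¹) x⁻¹x≈1)) (*-identityˡ y)))
    (λ y → trans (sym (*-assoc x⁻¹ x y)) (trans (*-congʳ x⁻¹x≈1) (*-identityˡ y)))
    where
    x⁻¹ = proj₁ (division 1# x≉0)
    x⁻¹x≈1 : x⁻¹ * x ≈ 1#
    x⁻¹x≈1 = proj₂ (division 1# x≉0)

  -- Scaling by x permutes the elements, so ∏ nonzeroOr1 (x y) = ∏ nonzeroOr1 y; termwise the
  -- left side is x^n ∏ nonzeroOr1 y up to the factor x missing at y = 0.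
  fermat-≉0 : ∀ {x} → x ≉ 0# → pow K x n ≈ x
  fermat-≉0 {x} x≉0 = sym (*-cancelˡ-≉0 (∏-≉0 G (λ i → nonzeroOr1-≉0 (enum i))) (begin
    ∏G * x                                         ≈⟨ *-congˡ (sym (∏-atZero x)) ⟩
    ∏G * ∏.sum A                                   ≈⟨ *-congʳ (∏.sum-permute G π) ⟩
    ∏.sum (λ i → G (π ⟨$⟩ʳ i)) * ∏.sum A           ≈⟨ sym (∏.∑-distrib-+ (λ i → G (π ⟨$⟩ʳ i)) A) ⟩
    ∏.sum (λ i → G (π ⟨$⟩ʳ i) * A i)               ≈⟨ ∏.sum-cong-≋ (λ i → trans (*-congʳ (nonzeroOr1-cong (enum-index _)))
                                                                                (nonzeroOr1-* x≉0 (enum i))) ⟩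
    ∏.sum (λ i → x * G i)                          ≈⟨ ∏.∑-distrib-+ (λ _ → x) G ⟩
    ∏.sum {n} (λ _ → x) * ∏G                       ≈⟨ *-congʳ (trans (∏.sum-replicate n) (reflexive (≡.sym (pow≡^ x n)))) ⟩
    pow K x n * ∏G                                 ≈⟨ *-comm _ _ ⟩
    ∏G * pow K x n                                 ∎))
    where
    G A : Fin n → Carrier
    G i = nonzeroOr1 (enum i)
    A i = atZero x (enum i)
    ∏G = ∏.sum G
    π = scaling x≉0

  fermat : ∀ x → pow K x n ≈ x
  fermat x with x ≟ 0#
  ... | no  x≉0 = fermat-≉0 x≉0
  ... | yes x≈0 = trans (pow-congˡ n x≈0) (trans (pow-0# n 1≤n) (sym x≈0))
    where
    1≤n : 1 ≤ n
    1≤n = ℕₚ.<-≤-trans (ℕ.s≤s ℕ.z≤n) (Finₚ.toℕ<n (index 0#))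

  ∃-pow≉id : ∀ {k} → 2 ≤ k → k < n → ∃ λ w → pow K w k ≉ w
  ∃-pow≉id {suc (suc k)} (ℕ.s≤s (ℕ.s≤s _)) k<n = enum (proj₁ unfixed) , proj₂ unfixed
    where
    Fixed : Fin n → Set ℓ
    Fixed i = pow K (enum i) (suc (suc k)) ≈ enum i
    r : Fin (suc (suc (suc k))) → Carrier
    r i = enum (inject≤ i k<n)
    r-injective : ∀ i j → r i ≈ r j → i ≡ j
    r-injective i j rᵢ≈rⱼ = Finₚ.inject≤-injective k<n k<n i j (enum-injective _ _ rᵢ≈rⱼ)
    all-fixed⇒⊥ : ¬ (∀ i → Fixed i)
    all-fixed⇒⊥ all-fixed = root-bound (pow-minus-id k) (length-pow-minus-id k) r r-injective
      (λ i → fixed-point-root k (all-fixed (inject≤ i k<n)))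
    unfixed : ∃ λ i → ¬ Fixed i
    unfixed = Finₚ.¬∀⟶∃¬ n Fixed (λ i → pow K (enum i) (suc (suc k)) ≟ enum i) all-fixed⇒⊥

module FieldOfSquareOrder {c ℓ : Level} (m : ℕ) (2≤m : 2 ≤ m) (K : CommutativeRing c ℓ)
                          (isField : IsField K) (card : HasCard K (2 ^ m *ℕ 2 ^ m)) where
  open CommutativeRing K hiding (zero)
  open Powers K
  open FieldProperties K isField
  open FiniteField K isField (2 ^ m *ℕ 2 ^ m) card
  open import Algebra.Solver.Ring.NaturalCoefficients commutativeSemiring (λ _ _ → nothing)
  open import Relation.Binary.Reasoning.Setoid setoid

  q : ℕ
  q = 2 ^ m

  1<q : 1 < q
  1<q = ℕₚ.^-monoʳ-≤ 2 (ℕₚ.<⇒≤ 2≤m)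

  1≤q : 1 ≤ q
  1≤q = ℕₚ.<⇒≤ 1<q

  char2 : HasCharacteristic2 K
  char2 = characteristic-two (m ℕ.+ m) (≡.sym (ℕₚ.^-distribˡ-+-* 2 m m))

  open CharacteristicTwo K char2

  pow-q-q : ∀ x → pow K (pow K x q) q ≈ x
  pow-q-q x = trans (pow-assocʳ x q q) (fermat x)

  ∃-pow-q-+≈1 : ∃ λ a → pow K a q + a ≈ 1#
  ∃-pow-q-+≈1 with ∃-pow≉id 1<q (ℕₚ.m<m*n q q {{ℕₚ.m^n≢0 2 m}} 1<q)
  ... | w , wᵠ≉w = a , *-cancelʳ-≉0 D≉0 (begin
    (pow K a q + a) * D     ≈⟨ distribʳ D (pow K a q) a ⟩
    pow K a q * D + a * D   ≈⟨ +-cong (*-congˡ (sym Dᵠ≈D)) aD≈w ⟩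
    pow K a q * pow K D q + w ≈⟨ +-congʳ (sym (pow-distrib-* a D q)) ⟩
    pow K (a * D) q + w     ≈⟨ +-congʳ (pow-congˡ q aD≈w) ⟩
    pow K w q + w           ≈⟨ +-comm _ _ ⟩
    D                       ≈⟨ sym (*-identityˡ D) ⟩
    1# * D                  ∎)
    where
    D = w + pow K w q
    D≉0 : D ≉ 0#
    D≉0 D≈0 = wᵠ≉w (sym (x+y≈0⇒x≈y D≈0))
    Dᵠ≈D : pow K D q ≈ D
    Dᵠ≈D = trans (pow-2^-+ w (pow K w q) m) (trans (+-congˡ (pow-q-q w)) (+-comm _ _))
    a = proj₁ (division w D≉0)
    aD≈w : a * D ≈ w
    aD≈w = proj₂ (division w D≉0)

  -- f(x) = x h(ρ) with ρ = x^(q-1), and ρ has norm ρ^(q+1) = 1 over 𝔽_q.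
  module PolarForm (t : Carrier) (tᵠ≈t : pow K t q ≈ t) where

    f : Carrier → Carrier
    f x = x + t * pow K x q + pow K x (2 *ℕ q ∸ 1)

    h : Carrier → Carrier
    h ρ = 1# + t * ρ + ρ * ρ

    NormOne : Carrier → Set ℓ
    NormOne ρ = pow K ρ q * ρ ≈ 1#

    f-cong : ∀ {x y} → x ≈ y → f x ≈ f y
    f-cong x≈y = +-cong (+-cong x≈y (*-congˡ (pow-congˡ q x≈y))) (pow-congˡ (2 *ℕ q ∸ 1) x≈y)

    h-cong : ∀ {ρ σ} → ρ ≈ σ → h ρ ≈ h σ
    h-cong ρ≈σ = +-cong (+-congˡ (*-congˡ ρ≈σ)) (*-cong ρ≈σ ρ≈σ)

    f-0 : f 0# ≈ 0#
    f-0 = begin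
      0# + t * pow K 0# q + pow K 0# (2 *ℕ q ∸ 1) ≈⟨ +-cong (+-congˡ (*-congˡ (pow-0# q 1≤q))) (pow-0# _ 1≤2q∸1) ⟩
      0# + t * 0# + 0#                           ≈⟨ +-identityʳ _ ⟩
      0# + t * 0#                                ≈⟨ +-identityˡ _ ⟩
      t * 0#                                     ≈⟨ zeroʳ t ⟩
      0#                                         ∎
      where
      1≤2q∸1 : 1 ≤ 2 *ℕ q ∸ 1
      1≤2q∸1 = ℕₚ.∸-monoˡ-≤ 1 (ℕₚ.*-monoʳ-≤ 2 1≤q)

    h-1 : h 1# ≈ t
    h-1 = trans (rearrange t) (trans (+-congˡ char2) (+-identityʳ t))
      where
      rearrange : ∀ t → 1# + t * 1# + 1# * 1# ≈ t + (1# + 1#)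
      rearrange = solve 1 (λ t → con 1 :+ t :* con 1 :+ con 1 :* con 1 := t :+ (con 1 :+ con 1)) refl

    ratio : ∀ {x} → x ≉ 0# → ∃ λ ρ → ρ * x ≈ pow K x q
    ratio x≉0 = division _ x≉0

    ratio-normOne : ∀ {x ρ} → x ≉ 0# → ρ * x ≈ pow K x q → NormOne ρ
    ratio-normOne {x} {ρ} x≉0 ρx≈xᵠ = *-cancelʳ-≉0 x≉0 (begin
      pow K ρ q * ρ * x       ≈⟨ *-assoc _ ρ x ⟩
      pow K ρ q * (ρ * x)     ≈⟨ *-congˡ ρx≈xᵠ ⟩
      pow K ρ q * pow K x q   ≈⟨ sym (pow-distrib-* ρ x q) ⟩
      pow K (ρ * x) q         ≈⟨ pow-congˡ q ρx≈xᵠ ⟩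
      pow K (pow K x q) q     ≈⟨ pow-q-q x ⟩
      x                       ≈⟨ sym (*-identityˡ x) ⟩
      1# * x                  ∎)

    f-ratio : ∀ {x ρ} → x ≉ 0# → ρ * x ≈ pow K x q → f x ≈ x * h ρ
    f-ratio {x} {ρ} x≉0 ρx≈xᵠ = begin
      x + t * pow K x q + pow K x (2 *ℕ q ∸ 1) ≈⟨ +-cong (+-congˡ (*-congˡ (sym ρx≈xᵠ))) pow[2q∸1]≈ρ²x ⟩
      x + t * (ρ * x) + ρ * ρ * x              ≈⟨ factor x ρ t ⟩
      x * h ρ                                  ∎
      where
      pow[2q∸1]≈ρ²x : pow K x (2 *ℕ q ∸ 1) ≈ ρ * ρ * x
      pow[2q∸1]≈ρ²x = *-cancelˡ-≉0 x≉0 (begin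
        x * pow K x (2 *ℕ q ∸ 1) ≈⟨ x*pow[2n∸1]≈pow[n]² x q 1≤q ⟩
        pow K x q * pow K x q    ≈⟨ sym (*-cong ρx≈xᵠ ρx≈xᵠ) ⟩
        (ρ * x) * (ρ * x)        ≈⟨ swap ρ x ⟩
        x * (ρ * ρ * x)          ∎)
        where
        swap : ∀ ρ x → (ρ * x) * (ρ * x) ≈ x * (ρ * ρ * x)
        swap = solve 2 (λ ρ x → (ρ :* x) :* (ρ :* x) := x :* (ρ :* ρ :* x)) refl
      factor : ∀ x ρ t → x + t * (ρ * x) + ρ * ρ * x ≈ x * (1# + t * ρ + ρ * ρ)
      factor = solve 3 (λ x ρ t → x :+ t :* (ρ :* x) :+ ρ :* ρ :* x := x :* (con 1 :+ t :* ρ :+ ρ :* ρ)) refl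

    pow-q-h : ∀ {ρ} → NormOne ρ → pow K (h ρ) q * (ρ * ρ) ≈ h ρ
    pow-q-h {ρ} N≈1 = begin
      pow K (h ρ) q * (ρ * ρ)                    ≈⟨ *-congʳ h-conj ⟩
      (1# + t * R + R * R) * (ρ * ρ)             ≈⟨ expand R ρ t ⟩
      ρ * ρ + t * (R * ρ) * ρ + (R * ρ) * (R * ρ) ≈⟨ +-cong (+-congˡ (*-congʳ (*-congˡ N≈1))) (*-cong N≈1 N≈1) ⟩
      ρ * ρ + t * 1# * ρ + 1# * 1#               ≈⟨ simplify ρ t ⟩
      h ρ                                        ∎
      where
      R = pow K ρ q
      h-conj : pow K (h ρ) q ≈ 1# + t * R + R * R
      h-conj = begin
        pow K (1# + t * ρ + ρ * ρ) q            ≈⟨ pow-2^-+ _ _ m ⟩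
        pow K (1# + t * ρ) q + pow K (ρ * ρ) q  ≈⟨ +-cong (pow-2^-+ _ _ m) (pow-distrib-* ρ ρ q) ⟩
        pow K 1# q + pow K (t * ρ) q + R * R    ≈⟨ +-congʳ (+-cong (pow-1# q) (trans (pow-distrib-* t ρ q) (*-congʳ tᵠ≈t))) ⟩
        1# + t * R + R * R                      ∎
      expand : ∀ R ρ t → (1# + t * R + R * R) * (ρ * ρ) ≈ ρ * ρ + t * (R * ρ) * ρ + (R * ρ) * (R * ρ)
      expand = solve 3 (λ R ρ t →
        (con 1 :+ t :* R :+ R :* R) :* (ρ :* ρ) := ρ :* ρ :+ t :* (R :* ρ) :* ρ :+ (R :* ρ) :* (R :* ρ)) refl
      simplify : ∀ ρ t → ρ * ρ + t * 1# * ρ + 1# * 1# ≈ 1# + t * ρ + ρ * ρ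
      simplify = solve 2 (λ ρ t → ρ :* ρ :+ t :* con 1 :* ρ :+ con 1 :* con 1 := con 1 :+ t :* ρ :+ ρ :* ρ) refl

    pow-q-f : ∀ {x ρ} → x ≉ 0# → ρ * x ≈ pow K x q → pow K (f x) q * ρ ≈ f x
    pow-q-f {x} {ρ} x≉0 ρx≈xᵠ = begin
      pow K (f x) q * ρ                 ≈⟨ *-congʳ (pow-congˡ q (f-ratio x≉0 ρx≈xᵠ)) ⟩
      pow K (x * h ρ) q * ρ             ≈⟨ *-congʳ (pow-distrib-* x (h ρ) q) ⟩
      pow K x q * pow K (h ρ) q * ρ     ≈⟨ *-congʳ (*-congʳ (sym ρx≈xᵠ)) ⟩
      ρ * x * pow K (h ρ) q * ρ         ≈⟨ rearrange ρ x (pow K (h ρ) q) ⟩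
      x * (pow K (h ρ) q * (ρ * ρ))     ≈⟨ *-congˡ (pow-q-h (ratio-normOne x≉0 ρx≈xᵠ)) ⟩
      x * h ρ                           ≈⟨ sym (f-ratio x≉0 ρx≈xᵠ) ⟩
      f x                               ∎
      where
      rearrange : ∀ ρ x H → ρ * x * H * ρ ≈ x * (H * (ρ * ρ))
      rearrange = solve 3 (λ ρ x H → ρ :* x :* H :* ρ := x :* (H :* (ρ :* ρ))) refl

    module _ (h-≉0 : ∀ {ρ} → NormOne ρ → h ρ ≉ 0#) where

      f-≉0 : ∀ {x} → x ≉ 0# → f x ≉ 0#
      f-≉0 x≉0 fx≈0 with ratio x≉0
      ... | ρ , ρx≈xᵠ = *-≉0 x≉0 (h-≉0 (ratio-normOne x≉0 ρx≈xᵠ)) (trans (sym (f-ratio x≉0 ρx≈xᵠ)) fx≈0)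

      -- The ratio of x is recovered from f(x) as f(x)^(1-q), and then x as f(x)/h(ρ).
      f-injective : ∀ x y → f x ≈ f y → x ≈ y
      f-injective x y fx≈fy with x ≟ 0# | y ≟ 0#
      ... | yes x≈0 | yes y≈0 = trans x≈0 (sym y≈0)
      ... | yes x≈0 | no  y≉0 = ⊥-elim (f-≉0 y≉0 (trans (sym fx≈fy) (trans (f-cong x≈0) f-0)))
      ... | no  x≉0 | yes y≈0 = ⊥-elim (f-≉0 x≉0 (trans fx≈fy (trans (f-cong y≈0) f-0)))
      ... | no  x≉0 | no  y≉0 with ratio x≉0 | ratio y≉0
      ...   | ρ , ρx≈xᵠ | σ , σy≈yᵠ = *-cancelʳ-≉0 (h-≉0 (ratio-normOne y≉0 σy≈yᵠ)) (begin
        x * h σ   ≈⟨ *-congˡ (h-cong (sym ρ≈σ)) ⟩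
        x * h ρ   ≈⟨ sym (f-ratio x≉0 ρx≈xᵠ) ⟩
        f x       ≈⟨ fx≈fy ⟩
        f y       ≈⟨ f-ratio y≉0 σy≈yᵠ ⟩
        y * h σ   ∎)
        where
        ρ≈σ : ρ ≈ σ
        ρ≈σ = *-cancelˡ-≉0 (pow-≉0 q (f-≉0 x≉0)) (begin
          pow K (f x) q * ρ ≈⟨ pow-q-f x≉0 ρx≈xᵠ ⟩
          f x               ≈⟨ fx≈fy ⟩
          f y               ≈⟨ sym (pow-q-f y≉0 σy≈yᵠ) ⟩
          pow K (f y) q * σ ≈⟨ *-congʳ (pow-congˡ q (sym fx≈fy)) ⟩
          pow K (f x) q * σ ∎)

      f-hits-≉0 : ∀ {z} → z ≉ 0# → ∃ λ x → f x ≈ z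
      f-hits-≉0 {z} z≉0 = x , trans (f-ratio x≉0 ρx≈xᵠ) xh≈z
        where
        zᵠ≉0 : pow K z q ≉ 0#
        zᵠ≉0 = pow-≉0 q z≉0
        ρ = proj₁ (division z zᵠ≉0)
        ρzᵠ≈z : ρ * pow K z q ≈ z
        ρzᵠ≈z = proj₂ (division z zᵠ≉0)
        ρzᵠ≈zᵠᵠ : ρ * pow K z q ≈ pow K (pow K z q) q
        ρzᵠ≈zᵠᵠ = trans ρzᵠ≈z (sym (pow-q-q z))
        hρ≉0 : h ρ ≉ 0#
        hρ≉0 = h-≉0 (ratio-normOne zᵠ≉0 ρzᵠ≈zᵠᵠ)
        x = proj₁ (division z hρ≉0)
        xh≈z : x * h ρ ≈ z
        xh≈z = proj₂ (division z hρ≉0)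
        x≉0 : x ≉ 0#
        x≉0 x≈0 = z≉0 (trans (sym xh≈z) (trans (*-congʳ x≈0) (zeroˡ _)))
        ρx≈xᵠ : ρ * x ≈ pow K x q
        ρx≈xᵠ = sym (*-cancelʳ-≉0 hρ≉0 (begin
          pow K x q * h ρ                         ≈⟨ *-congˡ (sym (pow-q-h (ratio-normOne zᵠ≉0 ρzᵠ≈zᵠᵠ))) ⟩
          pow K x q * (pow K (h ρ) q * (ρ * ρ))   ≈⟨ sym (*-assoc _ _ _) ⟩
          pow K x q * pow K (h ρ) q * (ρ * ρ)     ≈⟨ *-congʳ (sym (pow-distrib-* x (h ρ) q)) ⟩
          pow K (x * h ρ) q * (ρ * ρ)             ≈⟨ *-congʳ (pow-congˡ q xh≈z) ⟩
          pow K z q * (ρ * ρ)                     ≈⟨ rearrange (pow K z q) ρ ⟩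
          (ρ * pow K z q) * ρ                     ≈⟨ *-congʳ ρzᵠ≈z ⟩
          z * ρ                                   ≈⟨ *-comm z ρ ⟩
          ρ * z                                   ≈⟨ *-congˡ (sym xh≈z) ⟩
          ρ * (x * h ρ)                           ≈⟨ sym (*-assoc ρ x (h ρ)) ⟩
          ρ * x * h ρ                             ∎))
          where
          rearrange : ∀ a b → a * (b * b) ≈ (b * a) * b
          rearrange = solve 2 (λ a b → a :* (b :* b) := (b :* a) :* b) refl

      f-surjective : ∀ z → ∃ λ x → f x ≈ z
      f-surjective z with z ≟ 0#
      ... | yes z≈0 = 0# , trans f-0 (sym z≈0)
      ... | no  z≉0 = f-hits-≉0 z≉0

    module InverseTrace (t≉0 : t ≉ 0#) (u : Carrier) (tu≈1 : t * u ≈ 1#) where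

      uᵠ≈u : pow K u q ≈ u
      uᵠ≈u = *-cancelˡ-≉0 t≉0 (begin
        t * pow K u q          ≈⟨ *-congʳ (sym tᵠ≈t) ⟩
        pow K t q * pow K u q  ≈⟨ sym (pow-distrib-* t u q) ⟩
        pow K (t * u) q        ≈⟨ pow-congˡ q tu≈1 ⟩
        pow K 1# q             ≈⟨ pow-1# q ⟩
        1#                     ≈⟨ sym tu≈1 ⟩
        t * u                  ∎)

      Tr≉0⇒Tr≈1 : Tr m u ≉ 0# → Tr m u ≈ 1#
      Tr≉0⇒Tr≈1 T≉0 = x+y≈0⇒x≈y (*≈0⇒≈0 T≉0 (begin
        T * (T + 1#)   ≈⟨ distribˡ T T 1# ⟩
        T * T + T * 1# ≈⟨ +-congˡ (*-identityʳ T) ⟩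
        ℘ T            ≈⟨ ℘-Tr m u ⟩
        pow K u q + u  ≈⟨ +-congʳ uᵠ≈u ⟩
        u + u          ≈⟨ x+x≈0 u ⟩
        0#             ∎))
        where
        T = Tr m u

      -- A root ρ of h gives z = ρ u with ℘ z = u², so z^q + z = Tr(u²) = Tr(u)² = 0; hence ρ ∈ 𝔽_q,
      -- and norm one forces ρ² = 1, i.e. ρ = 1, but h 1 = t ≉ 0.
      h-≉0 : Tr m u ≈ 0# → ∀ {ρ} → NormOne ρ → h ρ ≉ 0#
      h-≉0 T≈0 {ρ} N≈1 hρ≈0 = t≉0 (trans (sym h-1) (trans (h-cong (sym ρ≈1)) hρ≈0))
        where
        z = ρ * u
        ℘z≈u² : ℘ z ≈ u * u
        ℘z≈u² = begin
          z * z + z             ≈⟨ +-congˡ (trans (sym (*-identityʳ z)) (*-congˡ (sym tu≈1))) ⟩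
          z * z + z * (t * u)   ≈⟨ factor ρ u t ⟩
          u * u * (t * ρ + ρ * ρ) ≈⟨ *-congˡ (sym (x+y≈0⇒x≈y (trans (sym (+-assoc 1# _ _)) hρ≈0))) ⟩
          u * u * 1#            ≈⟨ *-identityʳ _ ⟩
          u * u                 ∎
          where
          factor : ∀ ρ u t → (ρ * u) * (ρ * u) + (ρ * u) * (t * u) ≈ u * u * (t * ρ + ρ * ρ)
          factor = solve 3 (λ ρ u t → (ρ :* u) :* (ρ :* u) :+ (ρ :* u) :* (t :* u) := u :* u :* (t :* ρ :+ ρ :* ρ)) refl
        zᵠ≈z : pow K z q ≈ z
        zᵠ≈z = x+y≈0⇒x≈y (begin
          pow K z q + z     ≈⟨ sym (Tr-℘ m z) ⟩
          Tr m (℘ z)        ≈⟨ Tr-cong m ℘z≈u² ⟩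
          Tr m (u * u)      ≈⟨ Tr-square m u ⟩
          Tr m u * Tr m u   ≈⟨ *-congʳ T≈0 ⟩
          0# * Tr m u       ≈⟨ zeroˡ _ ⟩
          0#                ∎)
        ρᵠ≈ρ : pow K ρ q ≈ ρ
        ρᵠ≈ρ = *-cancelʳ-≉0 u≉0 (begin
          pow K ρ q * u          ≈⟨ *-congˡ (sym uᵠ≈u) ⟩
          pow K ρ q * pow K u q  ≈⟨ sym (pow-distrib-* ρ u q) ⟩
          pow K z q              ≈⟨ zᵠ≈z ⟩
          ρ * u                  ∎)
          where
          u≉0 : u ≉ 0#
          u≉0 u≈0 = 1≉0 (trans (sym tu≈1) (trans (*-congˡ u≈0) (zeroʳ t)))
        ρ≈1 : ρ ≈ 1#
        ρ≈1 = x+y≈0⇒x≈y (pow≈0⇒≈0 2 (begin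
          (ρ + 1#) * ((ρ + 1#) * 1#) ≈⟨ *-congˡ (*-identityʳ _) ⟩
          (ρ + 1#) * (ρ + 1#)        ≈⟨ square-+ ρ 1# ⟩
          ρ * ρ + 1# * 1#            ≈⟨ +-cong (trans (*-congʳ (sym ρᵠ≈ρ)) N≈1) (*-identityʳ 1#) ⟩
          1# + 1#                    ≈⟨ char2 ⟩
          0#                         ∎))

      -- With a^q + a = 1, z = Tr(u² a) satisfies ℘ z = u² and z^q = z + Tr(u)² = z + 1;
      -- then x = 1 + t z solves x² + t x + t = 0 and x^q = x + t, which makes f(x) vanish.
      nonzero-root : Tr m u ≈ 1# → ∃ λ x → x ≉ 0# × f x ≈ 0#
      nonzero-root T≈1 = x , x≉0 , *≈0⇒≈0 x≉0 xfx≈0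
        where
        a = proj₁ ∃-pow-q-+≈1
        aᵠ+a≈1 : pow K a q + a ≈ 1#
        aᵠ+a≈1 = proj₂ ∃-pow-q-+≈1
        z = Tr m (u * u * a)
        ℘z≈u² : ℘ z ≈ u * u
        ℘z≈u² = begin
          ℘ z                                 ≈⟨ ℘-Tr m (u * u * a) ⟩
          pow K (u * u * a) q + u * u * a     ≈⟨ +-congʳ (trans (pow-distrib-* (u * u) a q) (*-congʳ u²ᵠ≈u²)) ⟩
          u * u * pow K a q + u * u * a       ≈⟨ sym (distribˡ (u * u) _ a) ⟩
          u * u * (pow K a q + a)             ≈⟨ *-congˡ aᵠ+a≈1 ⟩
          u * u * 1#                          ≈⟨ *-identityʳ _ ⟩
          u * u                               ∎
          where
          u²ᵠ≈u² : pow K (u * u) q ≈ u * u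
          u²ᵠ≈u² = trans (pow-distrib-* u u q) (*-cong uᵠ≈u uᵠ≈u)
        zᵠ≈1+z : pow K z q ≈ 1# + z
        zᵠ≈1+z = x+y≈z⇒x≈z+y (begin
          pow K z q + z     ≈⟨ sym (Tr-℘ m z) ⟩
          Tr m (℘ z)        ≈⟨ Tr-cong m ℘z≈u² ⟩
          Tr m (u * u)      ≈⟨ Tr-square m u ⟩
          Tr m u * Tr m u   ≈⟨ *-cong T≈1 T≈1 ⟩
          1# * 1#           ≈⟨ *-identityʳ 1# ⟩
          1#                ∎)
        x = 1# + t * z
        quadratic : x * x + t * x + t ≈ 0#
        quadratic = begin
          x * x + t * x + t                                    ≈⟨ expand t z ⟩
          1# + t * t * ℘ z + ((t * z + t * z) + (t + t))       ≈⟨ +-cong (+-congˡ (*-congˡ ℘z≈u²)) (trans (+-cong (x+x≈0 _) (x+x≈0 t)) (+-identityʳ 0#)) ⟩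
          1# + t * t * (u * u) + 0#                            ≈⟨ +-identityʳ _ ⟩
          1# + t * t * (u * u)                                 ≈⟨ +-congˡ (trans (regroup t u) (*-cong tu≈1 tu≈1)) ⟩
          1# + 1# * 1#                                         ≈⟨ trans (+-congˡ (*-identityʳ 1#)) char2 ⟩
          0#                                                   ∎
          where
          expand : ∀ t z → (1# + t * z) * (1# + t * z) + t * (1# + t * z) + t ≈
                           1# + t * t * (z * z + z) + ((t * z + t * z) + (t + t))
          expand = solve 2 (λ t z → (con 1 :+ t :* z) :* (con 1 :+ t :* z) :+ t :* (con 1 :+ t :* z) :+ t :=
                                    con 1 :+ t :* t :* (z :* z :+ z) :+ ((t :* z :+ t :* z) :+ (t :+ t))) refl
          regroup : ∀ t u → t * t * (u * u) ≈ (t * u) * (t * u)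
          regroup = solve 2 (λ t u → t :* t :* (u :* u) := (t :* u) :* (t :* u)) refl
        xᵠ≈x+t : pow K x q ≈ x + t
        xᵠ≈x+t = begin
          pow K (1# + t * z) q           ≈⟨ pow-2^-+ 1# (t * z) m ⟩
          pow K 1# q + pow K (t * z) q   ≈⟨ +-cong (pow-1# q) (trans (pow-distrib-* t z q) (*-cong tᵠ≈t zᵠ≈1+z)) ⟩
          1# + t * (1# + z)              ≈⟨ expand t z ⟩
          1# + t * z + t                 ∎
          where
          expand : ∀ t z → 1# + t * (1# + z) ≈ 1# + t * z + t
          expand = solve 2 (λ t z → con 1 :+ t :* (con 1 :+ z) := con 1 :+ t :* z :+ t) refl
        x≉0 : x ≉ 0#
        x≉0 x≈0 = t≉0 (begin
          t                   ≈⟨ sym (+-identityˡ t) ⟩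
          0# + t              ≈⟨ +-congʳ (sym (pow-0# q 1≤q)) ⟩
          pow K 0# q + t      ≈⟨ +-congʳ (pow-congˡ q (sym x≈0)) ⟩
          pow K x q + t       ≈⟨ +-congʳ xᵠ≈x+t ⟩
          x + t + t           ≈⟨ +-assoc x t t ⟩
          x + (t + t)         ≈⟨ +-cong x≈0 (x+x≈0 t) ⟩
          0# + 0#             ≈⟨ +-identityʳ 0# ⟩
          0#                  ∎)
        xfx≈0 : x * f x ≈ 0#
        xfx≈0 = begin
          x * (x + t * X + pow K x (2 *ℕ q ∸ 1))                     ≈⟨ distribˡ x _ _ ⟩
          x * (x + t * X) + x * pow K x (2 *ℕ q ∸ 1)                 ≈⟨ +-congˡ (x*pow[2n∸1]≈pow[n]² x q 1≤q) ⟩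
          x * (x + t * X) + X * X                                    ≈⟨ +-cong (*-congˡ (+-congˡ (*-congˡ xᵠ≈x+t))) (*-cong xᵠ≈x+t xᵠ≈x+t) ⟩
          x * (x + t * (x + t)) + (x + t) * (x + t)                  ≈⟨ expand x t ⟩
          t * (x * x + t * x + t) + ((x * x + x * x) + (t * x + t * x)) ≈⟨ +-cong (*-congˡ quadratic) (trans (+-cong (x+x≈0 _) (x+x≈0 _)) (+-identityʳ 0#)) ⟩
          t * 0# + 0#                                                ≈⟨ trans (+-identityʳ _) (zeroʳ t) ⟩
          0#                                                         ∎
          where
          X = pow K x q
          expand : ∀ x t → x * (x + t * (x + t)) + (x + t) * (x + t) ≈
                           t * (x * x + t * x + t) + ((x * x + x * x) + (t * x + t * x))
          expand = solve 2 (λ x t → x :* (x :+ t :* (x :+ t)) :+ (x :+ t) :* (x :+ t) :=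
                                    t :* (x :* x :+ t :* x :+ t) :+ ((x :* x :+ x :* x) :+ (t :* x :+ t :* x))) refl

      injective⇒Tr≈0 : (∀ x y → f x ≈ f y → x ≈ y) → Tr m u ≈ 0#
      injective⇒Tr≈0 f-injective = decidable-stable (Tr m u ≟ 0#) λ T≉0 →
        let x , x≉0 , fx≈0 = nonzero-root (Tr≉0⇒Tr≈1 T≉0)
        in  x≉0 (f-injective x 0# (trans fx≈0 (sym f-0)))

theorem1p2 : {c ℓ : Level} (m : ℕ) → 2 ≤ m →
    (K : CommutativeRing c ℓ) → IsField K → HasCard K ((2 ^ m) *ℕ (2 ^ m)) →
    let open CommutativeRing K
        q = 2 ^ m
    in (t : Carrier) → pow K t q ≈ t → t ≉ 0# →
       (u : Carrier) → t * u ≈ 1# →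
       (IsPermutation K (λ x → x + t * pow K x q + pow K x (2 *ℕ q ∸ 1))
         ⇔ (AbsTrace K m u ≈ 0#))
theorem1p2 m 2≤m K isField card t tᵠ≈t t≉0 u tu≈1 =
  mk⇔ (λ f-permutation → injective⇒Tr≈0 (proj₁ f-permutation))
      (λ Tr≈0 → f-injective (h-≉0 Tr≈0) , f-surjective (h-≉0 Tr≈0))
  where
  open FieldOfSquareOrder m 2≤m K isField card
  open PolarForm t tᵠ≈t
  open InverseTrace t≉0 u tu≈1
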